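{- Let $G$ be a finite simple graph with $\mathrm{Aut}(G)\neq\{\mathrm{id}\}$, and let $\alpha\in\mathrm{Aut}(G)$ be such that $\theta(G)=c(\alpha)+1$. Then there is a prime number $p$ such that the order of $\alpha$ is $p$. In particular, every cycle of $\alpha$ (as a permutation of $V(G)$) has length $p$ or $1$.
   Context: For an automorphism $\alpha\neq\mathrm{id}$ of $G$, $c(\alpha)$ denotes the number of cycles in the cycle decomposition of $\alpha$ as a permutation of $V(G)$, fixed points counted as cycles of length 1; by convention $c(\mathrm{id})=0$. A vertex coloring is distinguishing if no non-identity automorphism of $G$ preserves it. The distinguishing threshold $\theta(G)$ is the minimum number $k$ such that every vertex coloring of $G$ using $k$ colors is distinguishing; equivalently $\theta(G)=1+\max\{c(\alpha):\alpha\in\mathrm{Aut}(G)\}$. -}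

module Defs where

open import Data.Nat using (ℕ; zero; suc; _+_; _≤_; _<_; _≤ᵇ_)
open import Data.Fin using (Fin; toℕ)
open import Data.Fin.Properties using (all?; _≟_)
open import Data.Fin.Permutation using (Permutation′; _⟨$⟩ʳ_)
open import Data.Bool using (Bool; true; false; if_then_else_)
open import Data.List using (List; upTo; allFin; map)
open import Data.Bool.ListAction using (all)
open import Data.Nat.ListAction using (sum)
open import Data.Product using (Σ; _×_; ∃)
open import Data.Empty using (⊥)
open import Relation.Nullary using (¬_; does)
open import Relation.Binary.PropositionalEquality using (_≡_)
open import Function.Bundles using (_⇔_)

record Graph (n : ℕ) : Set₁ where
  field
    Adj    : Fin n → Fin n → Set
    sym    : ∀ {u v} → Adj u v → Adj v u
    irrefl : ∀ {v} → ¬ Adj v v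
open Graph public

IsAut : ∀ {n} → Graph n → Permutation′ n → Set
IsAut G σ = ∀ u v → Adj G u v ⇔ Adj G (σ ⟨$⟩ʳ u) (σ ⟨$⟩ʳ v)

iter : ∀ {n} → ℕ → Permutation′ n → Fin n → Fin n
iter zero    σ v = v
iter (suc k) σ v = σ ⟨$⟩ʳ (iter k σ v)

IsId : ∀ {n} → Permutation′ n → Set
IsId σ = ∀ v → σ ⟨$⟩ʳ v ≡ v

-- v is the least element (w.r.t. toℕ) of its cycle; every cycle has a unique such vertex.
-- Orbits have size ≤ n, so iterates 0..n-1 cover the whole cycle.
minInCycle : ∀ {n} → Permutation′ n → Fin n → Bool
minInCycle {n} σ v = all (λ k → toℕ v ≤ᵇ toℕ (iter k σ v)) (upTo n)

numCycles : ∀ {n} → Permutation′ n → ℕ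
numCycles {n} σ = sum (map (λ v → if minInCycle σ v then 1 else 0) (allFin n))

-- c(α), with the convention c(id) = 0.
c : ∀ {n} → Permutation′ n → ℕ
c σ = if does (all? (λ v → σ ⟨$⟩ʳ v ≟ v)) then 0 else numCycles σ

IsDistThreshold : ∀ {n} → Graph n → ℕ → Set
IsDistThreshold G t =
  Σ _ (λ α → IsAut G α × t ≡ 1 + c α) × (∀ β → IsAut G β → 1 + c β ≤ t)

HasOrder : ∀ {n} → Permutation′ n → ℕ → Set
HasOrder σ p = 1 ≤ p × (∀ v → iter p σ v ≡ v)
               × (∀ k → 1 ≤ k → k < p → ¬ (∀ v → iter k σ v ≡ v))

CycleLength : ∀ {n} → Permutation′ n → Fin n → ℕ → Set
CycleLength σ v ℓ = 1 ≤ ℓ × iter ℓ σ v ≡ v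
                    × (∀ k → 1 ≤ k → k < ℓ → ¬ (iter k σ v ≡ v))

{-# OPTIONS --safe #-}
-- If α ^ q ≠ id, then α ^ q is again a non-identity automorphism, so by maximality of α it has
-- at most as many cycles as α. But every cycle of α is a union of cycles of α ^ q, and a cycle
-- of length d breaks into several as soon as d and q share a factor g > 1. Hence every cycle
-- length of α is coprime to every q with α ^ q ≠ id. Taking q a proper divisor of a cycle
-- length shows that all cycle lengths are 1 or prime, and taking q = r for a prime cycle
-- length r shows that all prime cycle lengths coincide.

module Submission where

open import Defs hiding (sym)
open import Data.Bool using (Bool; true; false; if_then_else_; T)
open import Data.Empty using (⊥-elim)
open import Data.Fin using (Fin; toℕ)
open import Data.Fin.Permutation using (Permutation′; _⟨$⟩ʳ_; _⟨$⟩ˡ_; inverseˡ; _∘ₚ_) renaming (id to idₚ)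
open import Data.Fin.Properties using (all?; ¬∀⟶∃¬; pigeonhole; toℕ-injective; toℕ<n; _≟_)
open import Data.List using (List; []; _∷_; upTo; allFin; map)
open import Data.List.Membership.Propositional using (_∈_)
open import Data.List.Membership.Propositional.Properties using (∈-upTo⁺; ∈-allFin)
open import Data.List.Relation.Unary.All as All using ()
open import Data.List.Relation.Unary.All.Properties using (all⁺; all⁻)
open import Data.List.Relation.Unary.Any using (here; there)
open import Data.Nat using (ℕ; zero; suc; _+_; _*_; _∸_; _≤_; _<_; z≤n; s≤s; s≤s⁻¹; NonZero; nonTrivial⇒≢1; nonTrivial⇒nonZero)
open import Data.Nat.Coprimality using (Coprime)
open import Data.Nat.Divisibility using (_∣_; divides; ∣-refl; ∣-trans; 1∣_; ∣⇒≤; 0∣⇒≡0; ∣1⇒≡1; n∣m*n; ∣m+n∣m⇒∣n; m%n≡0⇒n∣m)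
open import Data.Nat.DivMod using (_%_; _/_; m≡m%n+[m/n]*n; m%n<n)
open import Data.Nat.ListAction using (sum)
open import Data.Nat.Divisibility.Core using (hasNonTrivialDivisor)
open import Data.Nat.Primality using (Prime; prime?; ¬prime⇒composite; prime⇒irreducible; prime⇒nonTrivial)
open import Data.Nat.Properties using (≤-totalOrder; ≤-refl; ≤-trans; ≤-antisym; <-≤-trans; ≤-<-trans; <⇒≤; <⇒≱; >⇒≢; ≤ᵇ⇒≤; ≤⇒≤ᵇ; +-comm; +-suc; +-identityʳ; *-suc; +-mono-≤; +-mono-<-≤; +-mono-≤-<; m<1+n⇒m<n∨m≡n; m<n⇒0<n∸m; m∸n≤m; m∸n+n≡m; module ≤-Reasoning)
open import Data.List.Extrema ≤-totalOrder using (argmin; f[argmin]≤f[xs])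
open import Data.Product using (Σ; _×_; _,_; proj₁; proj₂)
open import Data.Sum using (_⊎_; inj₁; inj₂)
open import Function.Base using (id; _∘_)
open import Function.Construct.Composition using (_⇔-∘_)
open import Function.Construct.Identity using (⇔-id)
open import Relation.Binary.PropositionalEquality using (_≡_; _≢_; refl; sym; trans; cong; subst; module ≡-Reasoning)
open import Relation.Nullary using (¬_; yes; no)
open import Relation.Nullary.Decidable using (dec-true; dec-false)
open import Relation.Unary using (Decidable)

leastWitness : ∀ {p} {P : ℕ → Set p} → Decidable P → ∀ {m} → P m
             → Σ ℕ λ k → P k × (∀ j → j < k → ¬ P j)
leastWitness {P = P} P? {m} pm = search 0 m (λ _ ()) (subst P (sym (+-identityʳ m)) pm)
  where
  search : ∀ i d → (∀ j → j < i → ¬ P j) → P (d + i) → Σ ℕ λ k → P k × (∀ j → j < k → ¬ P j)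
  search i d       below p with P? i
  search i d       below p | yes pi = i , pi , below
  search i zero    below p | no ¬pi = ⊥-elim (¬pi p)
  search i (suc d) below p | no ¬pi = search (suc i) d below′ (subst P (sym (+-suc d i)) p)
    where
    below′ : ∀ j → j < suc i → ¬ P j
    below′ j j<1+i with m<1+n⇒m<n∨m≡n j<1+i
    ... | inj₁ j<i  = below j j<i
    ... | inj₂ refl = ¬pi

module _ {n : ℕ} (σ : Permutation′ n) where

  open ≡-Reasoning

  iter-+ : ∀ a b v → iter (a + b) σ v ≡ iter a σ (iter b σ v)
  iter-+ zero    b v = refl
  iter-+ (suc a) b v = cong (σ ⟨$⟩ʳ_) (iter-+ a b v)

  iter-comm : ∀ a b v → iter a σ (iter b σ v) ≡ iter b σ (iter a σ v)
  iter-comm a b v = begin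
    iter a σ (iter b σ v)  ≡⟨ iter-+ a b v ⟨
    iter (a + b) σ v       ≡⟨ cong (λ k → iter k σ v) (+-comm a b) ⟩
    iter (b + a) σ v       ≡⟨ iter-+ b a v ⟩
    iter b σ (iter a σ v)  ∎

  iter-injective : ∀ a {u v} → iter a σ u ≡ iter a σ v → u ≡ v
  iter-injective zero    eq = eq
  iter-injective (suc a) {u} {v} eq = iter-injective a (begin
    iter a σ u                       ≡⟨ inverseˡ σ ⟨
    σ ⟨$⟩ˡ (σ ⟨$⟩ʳ iter a σ u)        ≡⟨ cong (σ ⟨$⟩ˡ_) eq ⟩
    σ ⟨$⟩ˡ (σ ⟨$⟩ʳ iter a σ v)        ≡⟨ inverseˡ σ ⟩
    iter a σ v                       ∎)

  iter-* : ∀ k {d v} → iter d σ v ≡ v → iter (k * d) σ v ≡ v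
  iter-* zero    period = refl
  iter-* (suc k) {d} {v} period = begin
    iter (d + k * d) σ v         ≡⟨ iter-+ d (k * d) v ⟩
    iter d σ (iter (k * d) σ v)  ≡⟨ cong (iter d σ) (iter-* k period) ⟩
    iter d σ v                   ≡⟨ period ⟩
    v                            ∎

  iter-∣ : ∀ {d j v} → d ∣ j → iter d σ v ≡ v → iter j σ v ≡ v
  iter-∣ (divides k refl) = iter-* k

  iter-% : ∀ {d v} .{{_ : NonZero d}} → iter d σ v ≡ v → ∀ k → iter k σ v ≡ iter (k % d) σ v
  iter-% {d} {v} period k = begin
    iter k σ v                                ≡⟨ cong (λ i → iter i σ v) (m≡m%n+[m/n]*n k d) ⟩
    iter (k % d + (k / d) * d) σ v            ≡⟨ iter-+ (k % d) ((k / d) * d) v ⟩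
    iter (k % d) σ (iter ((k / d) * d) σ v)   ≡⟨ cong (iter (k % d) σ) (iter-* (k / d) period) ⟩
    iter (k % d) σ v                          ∎

  iter-period : ∀ v → Σ ℕ λ d → 0 < d × d ≤ n × iter d σ v ≡ v
  iter-period v with pigeonhole (s≤s ≤-refl) (λ i → iter (toℕ i) σ v)
  ... | i , j , i<j , eq = d , m<n⇒0<n∸m i<j , d≤n , iter-injective (toℕ i) (begin
    iter (toℕ i) σ (iter d σ v)  ≡⟨ iter-comm (toℕ i) d v ⟩
    iter d σ (iter (toℕ i) σ v)  ≡⟨ iter-+ d (toℕ i) v ⟨
    iter (d + toℕ i) σ v         ≡⟨ cong (λ k → iter k σ v) (m∸n+n≡m (<⇒≤ i<j)) ⟩
    iter (toℕ j) σ v             ≡⟨ eq ⟨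
    iter (toℕ i) σ v             ∎)
    where
    d : ℕ
    d = toℕ j ∸ toℕ i
    d≤n : d ≤ n
    d≤n = ≤-trans (m∸n≤m (toℕ j) (toℕ i)) (s≤s⁻¹ (toℕ<n j))

  iter-below : ∀ k v → Σ ℕ λ j → j < n × iter k σ v ≡ iter j σ v
  iter-below k v with iter-period v
  ... | suc d , _ , 1+d≤n , period = k % suc d , <-≤-trans (m%n<n k (suc d)) 1+d≤n , iter-% period k

  iter-return : ∀ j v → Σ ℕ λ i → iter i σ (iter j σ v) ≡ v
  iter-return j v with iter-period v
  ... | suc d , _ , _ , period = j * d , (begin
    iter (j * d) σ (iter j σ v)  ≡⟨ iter-comm (j * d) j v ⟩
    iter j σ (iter (j * d) σ v)  ≡⟨ iter-+ j (j * d) v ⟨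
    iter (j + j * d) σ v         ≡⟨ cong (λ i → iter i σ v) (*-suc j d) ⟨
    iter (j * suc d) σ v         ≡⟨ iter-* j period ⟩
    v                            ∎)

  cycleLength : ∀ v → Σ ℕ (CycleLength σ v)
  cycleLength v with iter-period v
  ... | suc d , _ , _ , period
        with leastWitness {P = λ k → iter (suc k) σ v ≡ v} (λ k → iter (suc k) σ v ≟ v) {d} period
  ...   | k , returns , before = suc k , s≤s z≤n , returns , earlier
    where
    earlier : ∀ j → 1 ≤ j → j < suc k → iter j σ v ≢ v
    earlier (suc j) _ j<k = before j (s≤s⁻¹ j<k)

  CycleLength-iter : ∀ a {v d} → CycleLength σ v d → CycleLength σ (iter a σ v) d
  CycleLength-iter a {v} {d} (1≤d , period , earlier) =
    1≤d , trans (iter-comm d a v) (cong (iter a σ) period) ,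
    λ k 1≤k k<d returns → earlier k 1≤k k<d (iter-injective a (trans (iter-comm a k v) returns))

  CycleLength⇒∣ : ∀ {v d j} → CycleLength σ v d → iter j σ v ≡ v → d ∣ j
  CycleLength⇒∣ {v} {suc d} {j} (_ , period , earlier) returns = m%n≡0⇒n∣m j (suc d)
    (remainder≡0 (j % suc d) (m%n<n j (suc d)) (trans (sym (iter-% period j)) returns))
    where
    remainder≡0 : ∀ r → r < suc d → iter r σ v ≡ v → r ≡ 0
    remainder≡0 zero    _   _  = refl
    remainder≡0 (suc r) r<d eq = ⊥-elim (earlier (suc r) (s≤s z≤n) r<d eq)

  IsCycleMin : Fin n → Set
  IsCycleMin v = ∀ k → toℕ v ≤ toℕ (iter k σ v)

  cycleMin : ∀ x → Σ ℕ λ a → IsCycleMin (iter a σ x)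
  cycleMin x = a , λ k → subst (λ y → f a ≤ toℕ y) (iter-+ k a x) (reduce (k + a))
    where
    f : ℕ → ℕ
    f j = toℕ (iter j σ x)
    a : ℕ
    a = argmin f 0 (upTo n)
    reduce : ∀ k → f a ≤ f k
    reduce k with iter-below k x
    ... | j , j<n , eq =
      subst (λ y → f a ≤ toℕ y) (sym eq) (All.lookup (f[argmin]≤f[xs] {f = f} 0 (upTo n)) (∈-upTo⁺ j<n))

  IsCycleMin-unique : ∀ {x j} → IsCycleMin x → IsCycleMin (iter j σ x) → iter j σ x ≡ x
  IsCycleMin-unique {x} {j} min-x min-y with iter-return j x
  ... | i , back =
    toℕ-injective (≤-antisym (subst (λ z → toℕ (iter j σ x) ≤ toℕ z) back (min-y i)) (min-x j))

  minInCycle⇒IsCycleMin : ∀ {v} → T (minInCycle σ v) → IsCycleMin v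
  minInCycle⇒IsCycleMin {v} isMin k with iter-below k v
  ... | j , j<n , eq = subst (λ y → toℕ v ≤ toℕ y) (sym eq)
                             (≤ᵇ⇒≤ _ _ (All.lookup (all⁺ _ (upTo n) isMin) (∈-upTo⁺ j<n)))

  IsCycleMin⇒minInCycle : ∀ {v} → IsCycleMin v → T (minInCycle σ v)
  IsCycleMin⇒minInCycle isMin = all⁻ _ {xs = upTo n} (All.tabulate λ {k} _ → ≤⇒≤ᵇ (isMin k))

indicator : Bool → ℕ
indicator b = if b then 1 else 0

indicator-mono : ∀ a b → (T a → T b) → indicator a ≤ indicator b
indicator-mono false _     _   = z≤n
indicator-mono true  true  _   = ≤-refl
indicator-mono true  false a⇒b = ⊥-elim (a⇒b _)

indicator-< : ∀ a b → ¬ T a → T b → indicator a < indicator b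
indicator-< false true  _  _  = s≤s z≤n
indicator-< true  _     ¬a _  = ⊥-elim (¬a _)

countTrue : ∀ {A : Set} → (A → Bool) → List A → ℕ
countTrue f xs = sum (map (λ x → indicator (f x)) xs)

module _ {A : Set} {f g : A → Bool} (f⇒g : ∀ x → T (f x) → T (g x)) where

  countTrue-mono : ∀ xs → countTrue f xs ≤ countTrue g xs
  countTrue-mono []       = z≤n
  countTrue-mono (x ∷ xs) = +-mono-≤ (indicator-mono (f x) (g x) (f⇒g x)) (countTrue-mono xs)

  countTrue-mono-< : ∀ {w xs} → w ∈ xs → ¬ T (f w) → T (g w) → countTrue f xs < countTrue g xs
  countTrue-mono-< {w} {_ ∷ xs} (here refl) ¬fw gw =
    +-mono-<-≤ (indicator-< (f w) (g w) ¬fw gw) (countTrue-mono xs)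
  countTrue-mono-< {xs = x ∷ _} (there w∈xs) ¬fw gw =
    +-mono-≤-< (indicator-mono (f x) (g x) (f⇒g x)) (countTrue-mono-< w∈xs ¬fw gw)

module _ {n : ℕ} where

  numCycles-< : ∀ (σ τ : Permutation′ n) → (∀ {v} → IsCycleMin σ v → IsCycleMin τ v)
              → Σ (Fin n) (λ w → IsCycleMin τ w × ¬ IsCycleMin σ w) → numCycles σ < numCycles τ
  numCycles-< σ τ σ⇒τ (w , τ-min-w , ¬σ-min-w) =
    countTrue-mono-< (λ v → IsCycleMin⇒minInCycle τ ∘ σ⇒τ {v} ∘ minInCycle⇒IsCycleMin σ)
                     (∈-allFin w) (¬σ-min-w ∘ minInCycle⇒IsCycleMin σ {w}) (IsCycleMin⇒minInCycle τ τ-min-w)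

  numCycles-pos : ∀ (σ : Permutation′ n) → Fin n → 0 < numCycles σ
  numCycles-pos σ v with cycleMin σ v
  ... | a , isMin = ≤-<-trans z≤n
    (countTrue-mono-< {f = λ _ → false} (λ _ ()) (∈-allFin (iter a σ v)) id (IsCycleMin⇒minInCycle σ isMin))

_^ₚ_ : ∀ {n} → Permutation′ n → ℕ → Permutation′ n
σ ^ₚ zero  = idₚ
σ ^ₚ suc k = (σ ^ₚ k) ∘ₚ σ

module _ {n : ℕ} (σ : Permutation′ n) where

  ^ₚ-apply : ∀ k v → (σ ^ₚ k) ⟨$⟩ʳ v ≡ iter k σ v
  ^ₚ-apply zero    v = refl
  ^ₚ-apply (suc k) v = cong (σ ⟨$⟩ʳ_) (^ₚ-apply k v)

  iter-^ₚ : ∀ k q v → iter k (σ ^ₚ q) v ≡ iter (k * q) σ v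
  iter-^ₚ zero    q v = refl
  iter-^ₚ (suc k) q v = begin
    (σ ^ₚ q) ⟨$⟩ʳ iter k (σ ^ₚ q) v  ≡⟨ ^ₚ-apply q _ ⟩
    iter q σ (iter k (σ ^ₚ q) v)     ≡⟨ cong (iter q σ) (iter-^ₚ k q v) ⟩
    iter q σ (iter (k * q) σ v)      ≡⟨ iter-+ σ q (k * q) v ⟨
    iter (q + k * q) σ v             ∎
    where open ≡-Reasoning

  IsCycleMin-^ₚ : ∀ q {v} → IsCycleMin σ v → IsCycleMin (σ ^ₚ q) v
  IsCycleMin-^ₚ q {v} isMin k = subst (λ y → toℕ v ≤ toℕ y) (sym (iter-^ₚ k q v)) (isMin (k * q))

module _ {n : ℕ} (G : Graph n) where

  IsAut-id : IsAut G idₚ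
  IsAut-id u v = ⇔-id _

  IsAut-∘ₚ : ∀ {π ρ} → IsAut G π → IsAut G ρ → IsAut G (π ∘ₚ ρ)
  IsAut-∘ₚ π-aut ρ-aut u v = ρ-aut _ _ ⇔-∘ π-aut u v

  IsAut-^ₚ : ∀ {σ} → IsAut G σ → ∀ k → IsAut G (σ ^ₚ k)
  IsAut-^ₚ σ-aut zero    = IsAut-id
  IsAut-^ₚ {σ} σ-aut (suc k) = IsAut-∘ₚ {σ ^ₚ k} {σ} (IsAut-^ₚ σ-aut k) σ-aut

module _ {n : ℕ} (σ : Permutation′ n) where

  c-IsId : IsId σ → c σ ≡ 0
  c-IsId σ-id =
    cong (λ b → if b then 0 else numCycles σ) (dec-true (all? (λ v → σ ⟨$⟩ʳ v ≟ v)) σ-id)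

  c-¬IsId : ¬ IsId σ → c σ ≡ numCycles σ
  c-¬IsId ¬σ-id =
    cong (λ b → if b then 0 else numCycles σ) (dec-false (all? (λ v → σ ⟨$⟩ʳ v ≟ v)) ¬σ-id)

  ¬IsId⇒moved : ¬ IsId σ → Σ (Fin n) λ v → σ ⟨$⟩ʳ v ≢ v
  ¬IsId⇒moved = ¬∀⟶∃¬ n _ (λ v → σ ⟨$⟩ʳ v ≟ v)

module _ {n : ℕ} (α : Permutation′ n) where

  ^ₚ-splits-cycle : ∀ {u d g q} → CycleLength α u d → 1 < g → g ∣ d → g ∣ q
                  → Σ (Fin n) λ w → IsCycleMin (α ^ₚ q) w × ¬ IsCycleMin α w
  -- m is least on its α-cycle and w least on the (α ^ₚ q)-cycle through α m. Then w lies on the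
  -- α-cycle of m, yet w ≠ m: otherwise d ∣ k * q + 1, which g ∣ d and g ∣ q forbid.
  ^ₚ-splits-cycle {u} {d} {g} {q} u-len 1<g g∣d g∣q with cycleMin α u
  ... | a , m-min with cycleMin (α ^ₚ q) (α ⟨$⟩ʳ iter a α u)
  ... | k , w-min = w , w-min , ¬w-min
    where
    m w : Fin n
    m = iter a α u
    w = iter k (α ^ₚ q) (α ⟨$⟩ʳ m)
    m↝w : iter (k * q + 1) α m ≡ w
    m↝w = trans (iter-+ α (k * q) 1 m) (sym (iter-^ₚ α k q (α ⟨$⟩ʳ m)))
    ¬w-min : ¬ IsCycleMin α w
    ¬w-min w-min′ = >⇒≢ 1<g (∣1⇒≡1 g∣1)
      where
      w≡m : iter (k * q + 1) α m ≡ m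
      w≡m = IsCycleMin-unique α {j = k * q + 1} m-min (subst (IsCycleMin α) (sym m↝w) w-min′)
      g∣1 : g ∣ 1
      g∣1 = ∣m+n∣m⇒∣n (∣-trans g∣d (CycleLength⇒∣ α (CycleLength-iter α a u-len) w≡m))
                      (∣-trans g∣q (n∣m*n k))

  numCycles<numCycles-^ₚ : ∀ {u d g q} → CycleLength α u d → 1 < g → g ∣ d → g ∣ q
                         → numCycles α < numCycles (α ^ₚ q)
  numCycles<numCycles-^ₚ {q = q} u-len 1<g g∣d g∣q =
    numCycles-< α (α ^ₚ q) (IsCycleMin-^ₚ α q) (^ₚ-splits-cycle u-len 1<g g∣d g∣q)

module _ {n : ℕ} (G : Graph n) {α : Permutation′ n} (α-max : ∀ β → IsAut G β → 1 + c β ≤ 1 + c α) where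

  open ≤-Reasoning

  maximal⇒¬IsId : Σ (Permutation′ n) (λ σ → IsAut G σ × ¬ IsId σ) → ¬ IsId α
  maximal⇒¬IsId (σ , σ-aut , ¬σ-id) α-id with ¬IsId⇒moved σ ¬σ-id
  ... | v , _ = <⇒≱ (numCycles-pos σ v) (begin
    numCycles σ  ≡⟨ c-¬IsId σ ¬σ-id ⟨
    c σ          ≤⟨ s≤s⁻¹ (α-max σ σ-aut) ⟩
    c α          ≡⟨ c-IsId α α-id ⟩
    0            ∎)

  maximal⇒coprime : IsAut G α → ¬ IsId α
                  → ∀ {q w v d} → iter q α w ≢ w → CycleLength α v d → Coprime d q
  maximal⇒coprime _ _ _ v-len {zero} (0∣d , _) = ⊥-elim (>⇒≢ (proj₁ v-len) (0∣⇒≡0 0∣d))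
  maximal⇒coprime _ _ _ _ {1} _ = refl
  maximal⇒coprime α-aut ¬α-id {q} {w} moves v-len {suc (suc g)} (g∣d , g∣q) =
    ⊥-elim (<⇒≱ (numCycles<numCycles-^ₚ α v-len (s≤s (s≤s z≤n)) g∣d g∣q) (begin
      numCycles (α ^ₚ q)  ≡⟨ c-¬IsId (α ^ₚ q) ¬αq-id ⟨
      c (α ^ₚ q)          ≤⟨ s≤s⁻¹ (α-max (α ^ₚ q) (IsAut-^ₚ G α-aut q)) ⟩
      c α                 ≡⟨ c-¬IsId α ¬α-id ⟩
      numCycles α         ∎))
    where
    ¬αq-id : ¬ IsId (α ^ₚ q)
    ¬αq-id αq-id = moves (trans (sym (^ₚ-apply α q w)) (αq-id w))

module _ {n : ℕ} {α : Permutation′ n}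
         (coprime : ∀ {q w v d} → iter q α w ≢ w → CycleLength α v d → Coprime d q) where

  CycleLength-1⊎prime : ∀ {v d} → CycleLength α v d → d ≡ 1 ⊎ Prime d
  CycleLength-1⊎prime {d = zero} (() , _)
  CycleLength-1⊎prime {d = 1} _ = inj₁ refl
  CycleLength-1⊎prime {v} {d = suc (suc d)} v-len with prime? (suc (suc d))
  ... | yes d-prime = inj₂ d-prime
  ... | no ¬d-prime with ¬prime⇒composite ¬d-prime
  ...   | hasNonTrivialDivisor {divisor = g} {{g-nontrivial}} g<d g∣d =
    ⊥-elim (nonTrivial⇒≢1 (coprime moves v-len (g∣d , ∣-refl)))
    where
    moves : iter g α v ≢ v
    moves returns = <⇒≱ g<d (∣⇒≤ {{nonTrivial⇒nonZero g}} (CycleLength⇒∣ α v-len returns))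

  prime-CycleLengths-≡ : ∀ {u v p r} → CycleLength α u p → CycleLength α v r → Prime p → Prime r → p ≡ r
  prime-CycleLengths-≡ {u} {r = r} u-len v-len p-prime r-prime with iter r α u ≟ u
  ... | no moves =
    ⊥-elim (nonTrivial⇒≢1 {{prime⇒nonTrivial r-prime}} (coprime moves v-len (∣-refl , ∣-refl)))
  ... | yes returns with prime⇒irreducible r-prime (CycleLength⇒∣ α u-len returns)
  ...   | inj₁ p≡1 = ⊥-elim (nonTrivial⇒≢1 {{prime⇒nonTrivial p-prime}} p≡1)
  ...   | inj₂ p≡r = p≡r

  moved⇒CycleLength-prime : ∀ {v p} → α ⟨$⟩ʳ v ≢ v → CycleLength α v p → Prime p
  moved⇒CycleLength-prime moves v-len with CycleLength-1⊎prime v-len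
  ... | inj₁ refl    = ⊥-elim (moves (proj₁ (proj₂ v-len)))
  ... | inj₂ p-prime = p-prime

  CycleLength-p⊎1 : ∀ {v₀ p} → Prime p → CycleLength α v₀ p
                  → ∀ v → CycleLength α v p ⊎ CycleLength α v 1
  CycleLength-p⊎1 p-prime v₀-len v with cycleLength α v
  ... | d , v-len with CycleLength-1⊎prime v-len
  ...   | inj₁ refl    = inj₂ v-len
  ...   | inj₂ d-prime =
    inj₁ (subst (CycleLength α v) (prime-CycleLengths-≡ v-len v₀-len d-prime p-prime) v-len)

CycleLengths⇒HasOrder : ∀ {n} {σ : Permutation′ n} {v₀ p} → CycleLength σ v₀ p
                      → (∀ v → CycleLength σ v p ⊎ CycleLength σ v 1) → HasOrder σ p
CycleLengths⇒HasOrder {σ = σ} {p = p} (1≤p , _ , earlier) lengths =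
  1≤p , period , λ k 1≤k k<p fixes → earlier k 1≤k k<p (fixes _)
  where
  period : ∀ v → iter p σ v ≡ v
  period v with lengths v
  ... | inj₁ (_ , returns , _) = returns
  ... | inj₂ (_ , fixed , _)   = iter-∣ σ (1∣ p) fixed

mainTheorem1 : (n : ℕ) (G : Graph n)
  → Σ (Permutation′ n) (λ σ → IsAut G σ × ¬ IsId σ)
  → (α : Permutation′ n) → IsAut G α
  → IsDistThreshold G (1 + c α)
  → Σ ℕ (λ p → Prime p × HasOrder α p
      × ((v : _) → CycleLength α v p ⊎ CycleLength α v 1))
mainTheorem1 n G nontrivial α α-aut (_ , α-max) =
  p , p-prime , CycleLengths⇒HasOrder v₀-len lengths , lengths
  where
  ¬α-id : ¬ IsId α
  ¬α-id = maximal⇒¬IsId G α-max nontrivial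
  coprime : ∀ {q w v d} → iter q α w ≢ w → CycleLength α v d → Coprime d q
  coprime = maximal⇒coprime G α-max α-aut ¬α-id
  v₀ : Fin n
  v₀ = proj₁ (¬IsId⇒moved α ¬α-id)
  v₀-moved : α ⟨$⟩ʳ v₀ ≢ v₀
  v₀-moved = proj₂ (¬IsId⇒moved α ¬α-id)
  p : ℕ
  p = proj₁ (cycleLength α v₀)
  v₀-len : CycleLength α v₀ p
  v₀-len = proj₂ (cycleLength α v₀)
  p-prime : Prime p
  p-prime = moved⇒CycleLength-prime coprime v₀-moved v₀-len
  lengths : ∀ v → CycleLength α v p ⊎ CycleLength α v 1
  lengths = CycleLength-p⊎1 coprime p-prime v₀-len
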